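{- Let $D\in\mathbb{Z}\setminus\{0,1\}$ be squarefree, $K=\mathbb{Q}(\sqrt{D})$ and $n\ge 1$. Then $\Gamma_K^n=\mathbb{Q}\left[z_1+\tau(z_1),\ \sqrt{D}(z_1-\tau(z_1)),\ \dots,\ z_n+\tau(z_n),\ \sqrt{D}(z_n-\tau(z_n))\right],$ i.e. $\Gamma_K^n$ is the $\mathbb{Q}$-subalgebra of the generalized polynomials generated by the $2n$ elements $z_k+\tau(z_k)$ and $\sqrt{D}(z_k-\tau(z_k))$, $k=1,\dots,n$.
   Context: $\tau: K\to K$, $a+b\sqrt{D}\mapsto a-b\sqrt{D}$ is the nontrivial automorphism. A generalized polynomial in $n$ variables over $K$ is a polynomial with coefficients in $K$ in the $2n$ independent indeterminates $z_1,\tau(z_1),\dots,z_n,\tau(z_n)$, written in multi-index notation as $g(\mathbf{z})=\sum_{\mathbf{i},\mathbf{j}\in\mathbb{Z}_{\ge0}^n}\alpha_{\mathbf{i}\mathbf{j}}\mathbf{z}^{\mathbf{i}}\tau(\mathbf{z})^{\mathbf{j}}$ (finitely many nonzero $\alpha_{\mathbf{i}\mathbf{j}}\in K$), where $\mathbf{z}^{\mathbf{i}}=z_1^{i_1}\cdots z_n^{i_n}$ and $\tau(\mathbf{z})^{\mathbf{j}}=\tau(z_1)^{j_1}\cdots\tau(z_n)^{j_n}$. It is evaluated at $\mathbf{a}\in K^n$ by substituting $a_k$ for $z_k$ and $\tau(a_k)$ for $\tau(z_k)$. $\Gamma_K^n$ denotes the ring of generalized polynomials $g$ in $n$ variables over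 $K$ such that $g(\mathbf{a})\in\mathbb{Q}$ for every $\mathbf{a}\in K^n$. -}

module Defs where

open import Data.Nat as ℕ using (ℕ; zero; suc)
open import Data.Integer as ℤ using (ℤ)
open import Data.Rational as ℚ using (ℚ; 0ℚ; 1ℚ)
open import Data.Fin using (Fin)
open import Data.Vec using (Vec; []; _∷_; replicate; _[_]≔_; zipWith)
open import Data.Vec.Properties using (≡-dec)
open import Data.List using (List; []; _∷_; _++_; map; concatMap)
open import Data.Product using (_×_; _,_; Σ; proj₁; proj₂)
open import Relation.Nullary using (yes; no)
open import Relation.Binary.PropositionalEquality using (_≡_)

record K : Set where
  constructor _+√D·_
  field
    re : ℚ
    im : ℚ
open K public

module Field (D : ℤ) where

  Dℚ : ℚ
  Dℚ = D ℚ./ 1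

  _+K_ : K → K → K
  (a +√D· b) +K (c +√D· d) = (a ℚ.+ c) +√D· (b ℚ.+ d)

  _*K_ : K → K → K
  (a +√D· b) *K (c +√D· d) = ((a ℚ.* c) ℚ.+ (Dℚ ℚ.* (b ℚ.* d))) +√D· ((a ℚ.* d) ℚ.+ (b ℚ.* c))

  0K 1K √D : K
  0K = 0ℚ +√D· 0ℚ
  1K = 1ℚ +√D· 0ℚ
  √D = 0ℚ +√D· 1ℚ

  ι : ℚ → K
  ι q = q +√D· 0ℚ

  τ : K → K
  τ (a +√D· b) = a +√D· (ℚ.- b)

  _^K_ : K → ℕ → K
  x ^K zero = 1K
  x ^K suc k = x *K (x ^K k)

  -- Generalized polynomials in n variables over K: finite formal sums of
  -- terms  α · z^i · τ(z)^j, with i j : Vec ℕ n multi-indices.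
  -- A polynomial is a list of terms; two lists represent the same
  -- polynomial iff all their coefficients agree (formal equality).

  Term : ℕ → Set
  Term n = K × Vec ℕ n × Vec ℕ n

  GPoly : ℕ → Set
  GPoly n = List (Term n)

  coeff : ∀ {n} → GPoly n → Vec ℕ n → Vec ℕ n → K
  coeff [] i j = 0K
  coeff ((α , i′ , j′) ∷ p) i j with ≡-dec ℕ._≟_ i i′ | ≡-dec ℕ._≟_ j j′
  ... | yes _ | yes _ = α +K coeff p i j
  ... | _     | _     = coeff p i j

  _≈P_ : ∀ {n} → GPoly n → GPoly n → Set
  p ≈P q = ∀ i j → coeff p i j ≡ coeff q i j

  _+P_ : ∀ {n} → GPoly n → GPoly n → GPoly n
  p +P q = p ++ q

  _*P_ : ∀ {n} → GPoly n → GPoly n → GPoly n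
  p *P q = concatMap (λ { (α , i , j) →
             map (λ { (β , i′ , j′) → (α *K β , zipWith ℕ._+_ i i′ , zipWith ℕ._+_ j j′) }) q }) p

  constP : ∀ {n} → K → GPoly n
  constP {n} α = (α , replicate n 0 , replicate n 0) ∷ []

  zP : ∀ {n} → Fin n → GPoly n
  zP {n} k = (1K , replicate n 0 [ k ]≔ 1 , replicate n 0) ∷ []

  τzP : ∀ {n} → Fin n → GPoly n
  τzP {n} k = (1K , replicate n 0 , replicate n 0 [ k ]≔ 1) ∷ []

  monoEval : ∀ {n} → Vec K n → Vec ℕ n → Vec ℕ n → K
  monoEval [] [] [] = 1K
  monoEval (a ∷ as) (i ∷ is) (j ∷ js) =
    ((a ^K i) *K (τ a ^K j)) *K monoEval as is js

  eval : ∀ {n} → GPoly n → Vec K n → K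
  eval [] a = 0K
  eval ((α , i , j) ∷ p) a = (α *K monoEval a i j) +K eval p a

  -- g ∈ Γ_K^n : g(a) ∈ ℚ for every a ∈ Kⁿ
  InΓ : ∀ {n} → GPoly n → Set
  InΓ g = ∀ a → im (eval g a) ≡ 0ℚ

  -- The ℚ-subalgebra generated by  x_k = z_k + τ(z_k)  and
  -- y_k = √D (z_k - τ(z_k)): images of ℚ-polynomial expressions
  -- in these 2n generators.

  xP : ∀ {n} → Fin n → GPoly n
  xP k = zP k +P τzP k

  yP : ∀ {n} → Fin n → GPoly n
  yP k = (constP √D *P zP k) +P (constP (τ √D) *P τzP k)

  data QExpr (n : ℕ) : Set where
    cst  : ℚ → QExpr n
    genX : Fin n → QExpr n
    genY : Fin n → QExpr n
    _⊕_  : QExpr n → QExpr n → QExpr n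
    _⊗_  : QExpr n → QExpr n → QExpr n

  ⟦_⟧ : ∀ {n} → QExpr n → GPoly n
  ⟦ cst q ⟧  = constP (ι q)
  ⟦ genX k ⟧ = xP k
  ⟦ genY k ⟧ = yP k
  ⟦ e ⊕ f ⟧  = ⟦ e ⟧ +P ⟦ f ⟧
  ⟦ e ⊗ f ⟧  = ⟦ e ⟧ *P ⟦ f ⟧

  InSubalg : ∀ {n} → GPoly n → Set
  InSubalg g = Σ (QExpr _) λ e → ⟦ e ⟧ ≈P g

SquareFree : ℤ → Set
SquareFree D = ∀ (m : ℕ) → (m ℕ.* m) Data.Nat.Divisibility.∣ ℤ.∣ D ∣ → m ≡ 1
  where import Data.Nat.Divisibility

{-# OPTIONS --safe #-}
module Submission where

-- A generalized polynomial is determined by the function it induces on Kⁿ, since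
-- K = ℚ(√D) is an infinite field (D is not a square): along a = t(m + √D) with t, m ∈ ℕ,
-- root counting in t separates the total degree k + l of z^k τ(z)^l, and root counting in
-- the ratio (m + √D)/(m − √D) then separates k.  Since z = x/2 + (y/2D)√D with
-- x = z + τ(z) and y = √D(z − τ(z)), both coordinates of g(a) in the basis 1, √D are
-- ℚ-polynomials in the values of the generators x_k, y_k.  If g takes rational values it
-- agrees with its first coordinate as a function, hence as a generalized polynomial;
-- conversely every element of the algebra generated by the x_k, y_k takes rational values.

open import Defs
open import Data.Nat using (ℕ; _≥_)
open import Data.Integer using (ℤ; 0ℤ; 1ℤ)
open import Relation.Binary.PropositionalEquality using (_≢_)
open import Function.Bundles using (_⇔_; mk⇔)

open import Algebra.Bundles using (CommutativeSemiring; CommutativeRing)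
open import Algebra.Definitions using (AlmostLeftCancellative)
open import Algebra.Structures using (IsCommutativeRing)
open import Data.Nat as ℕ using (zero; suc; _<_; s≤s)
import Data.Nat.Properties as ℕ
open import Data.Nat.Divisibility using (_∣_; divides; ∣-refl; ∣-reflexive)
import Data.Nat.Coprimality as Coprime
open import Data.Integer as ℤ using (+_; -[1+_]; ∣_∣)
import Data.Integer.Properties as ℤ
open import Data.Integer.GCD using (gcd; gcd-zeroʳ)
open import Data.Rational as ℚ using (ℚ; mkℚ; ↥_; ↧_; 0ℚ; 1ℚ)
import Data.Rational.Properties as ℚ
open import Data.Fin using (Fin; zero; suc; toℕ; fromℕ<)
open import Data.Fin.Properties using (toℕ<n; toℕ-fromℕ<)
open import Data.Vec using (Vec; []; _∷_; lookup; tail; tabulate; replicate; zipWith; _[_]≔_)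
open import Data.Vec.Properties using (≡-dec; ∷-injectiveˡ; ∷-injectiveʳ)
open import Data.Vec.Relation.Unary.All as VecAll using ([]; _∷_)
open import Data.Vec.Relation.Unary.All.Properties using (tabulate⁻)
open import Data.List using ([]; _∷_; _++_; map)
open import Data.List.Relation.Unary.All as ListAll using ([]; _∷_)
import Data.List.Relation.Unary.All.Properties as ListAllₚ
open import Data.Product using (_×_; _,_; ∃)
open import Data.Sum using (_⊎_; inj₁; inj₂)
open import Function using (_∘_)
open import Relation.Nullary using (yes; no; ¬_; contradiction)
open import Relation.Nullary.Decidable using (dec⇒maybe; _×-dec_)
open import Relation.Binary.PropositionalEquality
  using (_≡_; refl; sym; trans; cong; cong₂; subst; isEquivalence; module ≡-Reasoning)
open import Tactic.RingSolver using (solve-∀)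
open import Tactic.RingSolver.Core.AlmostCommutativeRing using (AlmostCommutativeRing; fromCommutativeRing)

-- Finite sums

InBox : ∀ {n} → ℕ → Vec ℕ n → Set
InBox B = VecAll.All (_< B)

module FiniteSums {c ℓ} (R : CommutativeSemiring c ℓ) where

  open CommutativeSemiring R renaming (refl to ≈-refl; sym to ≈-sym; trans to ≈-trans)
  open import Algebra.Properties.Semiring.Sum semiring
  open import Relation.Binary.Reasoning.Setoid setoid

  ∑ℕ : ℕ → (ℕ → Carrier) → Carrier
  ∑ℕ B f = ∑[ i < B ] f (toℕ i)

  syntax ∑ℕ B (λ k → e) = ∑ℕ[ k < B ] e

  ∑ℕ-cong : ∀ B {f g : ℕ → Carrier} → (∀ k → k < B → f k ≈ g k) → ∑ℕ B f ≈ ∑ℕ B g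
  ∑ℕ-cong B f≈g = sum-cong-≋ (λ i → f≈g (toℕ i) (toℕ<n i))

  ∑ℕ-zero : ∀ B → ∑ℕ[ k < B ] 0# ≈ 0#
  ∑ℕ-zero = sum-replicate-zero

  ∑ℕ-distrib-+ : ∀ B (f g : ℕ → Carrier) → ∑ℕ[ k < B ] (f k + g k) ≈ ∑ℕ B f + ∑ℕ B g
  ∑ℕ-distrib-+ B f g = ∑-distrib-+ {B} (f ∘ toℕ) (g ∘ toℕ)

  ∑ℕ-distribˡ-* : ∀ B (f : ℕ → Carrier) x → x * ∑ℕ B f ≈ ∑ℕ[ k < B ] (x * f k)
  ∑ℕ-distribˡ-* B f x = *-distribˡ-sum {B} x (f ∘ toℕ)

  ∑ℕ-distribʳ-* : ∀ B (f : ℕ → Carrier) x → ∑ℕ B f * x ≈ ∑ℕ[ k < B ] (f k * x)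
  ∑ℕ-distribʳ-* B f x = *-distribʳ-sum {B} x (f ∘ toℕ)

  ∑ℕ-comm : ∀ B C (f : ℕ → ℕ → Carrier) → ∑ℕ[ k < B ] ∑ℕ[ l < C ] f k l ≈ ∑ℕ[ l < C ] ∑ℕ[ k < B ] f k l
  ∑ℕ-comm B C f = ∑-comm {B} {C} (λ i j → f (toℕ i) (toℕ j))

  ∑ℕ-single : ∀ {B} (f : ℕ → Carrier) {i} → i < B → (∀ k → k ≢ i → f k ≈ 0#) → ∑ℕ B f ≈ f i
  ∑ℕ-single {suc B} f {zero} _ f≈0 = begin
    f 0 + ∑ℕ[ k < B ] f (suc k) ≈⟨ +-congˡ (≈-trans (∑ℕ-cong B λ k _ → f≈0 (suc k) λ ()) (∑ℕ-zero B)) ⟩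
    f 0 + 0#                    ≈⟨ +-identityʳ (f 0) ⟩
    f 0                         ∎
  ∑ℕ-single {suc B} f {suc i} (s≤s i<B) f≈0 = begin
    f 0 + ∑ℕ[ k < B ] f (suc k) ≈⟨ +-cong (f≈0 0 λ ()) (∑ℕ-single (f ∘ suc) i<B tail≈0) ⟩
    0# + f (suc i)              ≈⟨ +-identityˡ (f (suc i)) ⟩
    f (suc i)                   ∎
    where
    tail≈0 : ∀ k → k ≢ i → f (suc k) ≈ 0#
    tail≈0 k k≢i = f≈0 (suc k) (k≢i ∘ ℕ.suc-injective)

  δ : ℕ → ℕ → Carrier → Carrier
  δ d s x with d ℕ.≟ s
  ... | yes _ = x
  ... | no  _ = 0#

  δ-refl : ∀ d x → δ d d x ≈ x
  δ-refl d x with d ℕ.≟ d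
  ... | yes _   = ≈-refl
  ... | no  d≢d = contradiction refl d≢d

  δ-≢ : ∀ {d s} x → d ≢ s → δ d s x ≈ 0#
  δ-≢ {d} {s} x d≢s with d ℕ.≟ s
  ... | yes d≡s = contradiction d≡s d≢s
  ... | no  _   = ≈-refl

  δ-*ʳ : ∀ d s x y → δ d s x * y ≈ δ d s (x * y)
  δ-*ʳ d s x y with d ℕ.≟ s
  ... | yes _ = ≈-refl
  ... | no  _ = zeroˡ y

  ∑ℕ-δ : ∀ {N s} (f : ℕ → Carrier) → s < N → ∑ℕ[ d < N ] δ d s (f d) ≈ f s
  ∑ℕ-δ {s = s} f s<N = ≈-trans (∑ℕ-single (λ d → δ d s (f d)) s<N (λ d → δ-≢ (f d))) (δ-refl s (f s))

  ∑ℕ-regroup : ∀ B (f : ℕ → ℕ → Carrier) (g : ℕ → Carrier) →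
               ∑ℕ[ k < B ] ∑ℕ[ l < B ] (f k l * g (k ℕ.+ l)) ≈
               ∑ℕ[ d < B ℕ.+ B ] ((∑ℕ[ k < B ] ∑ℕ[ l < B ] δ d (k ℕ.+ l) (f k l)) * g d)
  ∑ℕ-regroup B f g = begin
    ∑ℕ[ k < B ] ∑ℕ[ l < B ] (f k l * g (k ℕ.+ l))
      ≈⟨ ∑ℕ-cong B (λ k k<B → ∑ℕ-cong B λ l l<B → ≈-sym (∑ℕ-δ (λ d → f k l * g d) (ℕ.+-mono-< k<B l<B))) ⟩
    ∑ℕ[ k < B ] ∑ℕ[ l < B ] ∑ℕ[ d < N ] δ d (k ℕ.+ l) (f k l * g d)
      ≈⟨ ∑ℕ-cong B (λ k _ → ∑ℕ-comm B N λ l d → δ d (k ℕ.+ l) (f k l * g d)) ⟩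
    ∑ℕ[ k < B ] ∑ℕ[ d < N ] ∑ℕ[ l < B ] δ d (k ℕ.+ l) (f k l * g d)
      ≈⟨ ∑ℕ-comm B N (λ k d → ∑ℕ[ l < B ] δ d (k ℕ.+ l) (f k l * g d)) ⟩
    ∑ℕ[ d < N ] ∑ℕ[ k < B ] ∑ℕ[ l < B ] δ d (k ℕ.+ l) (f k l * g d)
      ≈⟨ ∑ℕ-cong N (λ d _ → ∑ℕ-cong B λ k _ → ∑ℕ-cong B λ l _ → ≈-sym (δ-*ʳ d (k ℕ.+ l) (f k l) (g d))) ⟩
    ∑ℕ[ d < N ] ∑ℕ[ k < B ] ∑ℕ[ l < B ] (δ d (k ℕ.+ l) (f k l) * g d)
      ≈⟨ ∑ℕ-cong N (λ d _ → ≈-trans (∑ℕ-cong B λ k _ → ≈-sym (∑ℕ-distribʳ-* B (F d k) (g d)))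
                                     (≈-sym (∑ℕ-distribʳ-* B (λ k → ∑ℕ B (F d k)) (g d)))) ⟩
    ∑ℕ[ d < N ] ((∑ℕ[ k < B ] ∑ℕ[ l < B ] δ d (k ℕ.+ l) (f k l)) * g d) ∎
    where
    N = B ℕ.+ B
    F : ℕ → ℕ → ℕ → Carrier
    F d k l = δ d (k ℕ.+ l) (f k l)

  boxSum : ∀ n → ℕ → (Vec ℕ n → Vec ℕ n → Carrier) → Carrier
  boxSum zero    B f = f [] []
  boxSum (suc n) B f = ∑ℕ[ k < B ] ∑ℕ[ l < B ] boxSum n B (λ i j → f (k ∷ i) (l ∷ j))

  boxSum-cong : ∀ n B {f g : Vec ℕ n → Vec ℕ n → Carrier} →
                (∀ i j → f i j ≈ g i j) → boxSum n B f ≈ boxSum n B g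
  boxSum-cong zero    B f≈g = f≈g [] []
  boxSum-cong (suc n) B f≈g = ∑ℕ-cong B λ k _ → ∑ℕ-cong B λ l _ → boxSum-cong n B λ i j → f≈g (k ∷ i) (l ∷ j)

  boxSum-zero : ∀ n B {f : Vec ℕ n → Vec ℕ n → Carrier} →
                (∀ i j → f i j ≈ 0#) → boxSum n B f ≈ 0#
  boxSum-zero zero    B     f≈0 = f≈0 [] []
  boxSum-zero (suc n) B {f} f≈0 = begin
    boxSum (suc n) B f         ≈⟨ ∑ℕ-cong B (λ k _ → ∑ℕ-cong B λ l _ →
                                    boxSum-zero n B λ i j → f≈0 (k ∷ i) (l ∷ j)) ⟩
    ∑ℕ[ k < B ] ∑ℕ[ l < B ] 0# ≈⟨ ∑ℕ-cong B (λ _ _ → ∑ℕ-zero B) ⟩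
    ∑ℕ[ k < B ] 0#             ≈⟨ ∑ℕ-zero B ⟩
    0#                         ∎

  boxSum-distrib-+ : ∀ n B (f g : Vec ℕ n → Vec ℕ n → Carrier) →
                     boxSum n B (λ i j → f i j + g i j) ≈ boxSum n B f + boxSum n B g
  boxSum-distrib-+ zero    B f g = ≈-refl
  boxSum-distrib-+ (suc n) B f g = begin
    ∑ℕ[ k < B ] ∑ℕ[ l < B ] boxSum n B (λ i j → F k l i j + G k l i j)
      ≈⟨ ∑ℕ-cong B (λ k _ → ∑ℕ-cong B λ l _ → boxSum-distrib-+ n B (F k l) (G k l)) ⟩
    ∑ℕ[ k < B ] ∑ℕ[ l < B ] (boxSum n B (F k l) + boxSum n B (G k l))
      ≈⟨ ∑ℕ-cong B (λ k _ → ∑ℕ-distrib-+ B (boxSum n B ∘ F k) (boxSum n B ∘ G k)) ⟩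
    ∑ℕ[ k < B ] (∑ℕ[ l < B ] boxSum n B (F k l) + ∑ℕ[ l < B ] boxSum n B (G k l))
      ≈⟨ ∑ℕ-distrib-+ B (λ k → ∑ℕ B (boxSum n B ∘ F k)) (λ k → ∑ℕ B (boxSum n B ∘ G k)) ⟩
    boxSum (suc n) B f + boxSum (suc n) B g ∎
    where
    F G : ℕ → ℕ → Vec ℕ n → Vec ℕ n → Carrier
    F k l i j = f (k ∷ i) (l ∷ j)
    G k l i j = g (k ∷ i) (l ∷ j)

  boxSum-distribʳ-* : ∀ n B (f : Vec ℕ n → Vec ℕ n → Carrier) x →
                      boxSum n B f * x ≈ boxSum n B (λ i j → f i j * x)
  boxSum-distribʳ-* zero    B f x = ≈-refl
  boxSum-distribʳ-* (suc n) B f x = begin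
    (∑ℕ[ k < B ] ∑ℕ[ l < B ] boxSum n B (F k l)) * x
      ≈⟨ ∑ℕ-distribʳ-* B (λ k → ∑ℕ B (boxSum n B ∘ F k)) x ⟩
    ∑ℕ[ k < B ] ((∑ℕ[ l < B ] boxSum n B (F k l)) * x)
      ≈⟨ ∑ℕ-cong B (λ k _ → ∑ℕ-distribʳ-* B (boxSum n B ∘ F k) x) ⟩
    ∑ℕ[ k < B ] ∑ℕ[ l < B ] (boxSum n B (F k l) * x)
      ≈⟨ ∑ℕ-cong B (λ k _ → ∑ℕ-cong B λ l _ → boxSum-distribʳ-* n B (F k l) x) ⟩
    boxSum (suc n) B (λ i j → f i j * x) ∎
    where
    F : ℕ → ℕ → Vec ℕ n → Vec ℕ n → Carrier
    F k l i j = f (k ∷ i) (l ∷ j)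

  boxSum-single : ∀ {n B} (f : Vec ℕ n → Vec ℕ n → Carrier) {i₀ j₀} → InBox B i₀ → InBox B j₀ →
                  (∀ i j → i ≢ i₀ ⊎ j ≢ j₀ → f i j ≈ 0#) → boxSum n B f ≈ f i₀ j₀
  boxSum-single {zero}      f [] [] _ = ≈-refl
  boxSum-single {suc n} {B} f {a ∷ i₀} {b ∷ j₀} (a<B ∷ i₀∈B) (b<B ∷ j₀∈B) f≈0 = begin
    ∑ℕ[ k < B ] ∑ℕ[ l < B ] boxSum n B (F k l) ≈⟨ ∑ℕ-single (λ k → ∑ℕ B (boxSum n B ∘ F k)) a<B row≈0 ⟩
    ∑ℕ[ l < B ] boxSum n B (F a l)             ≈⟨ ∑ℕ-single (boxSum n B ∘ F a) b<B column≈0 ⟩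
    boxSum n B (F a b)                         ≈⟨ boxSum-single (F a b) i₀∈B j₀∈B tails≈0 ⟩
    f (a ∷ i₀) (b ∷ j₀)                        ∎
    where
    F : ℕ → ℕ → Vec ℕ n → Vec ℕ n → Carrier
    F k l i j = f (k ∷ i) (l ∷ j)
    row≈0 : ∀ k → k ≢ a → ∑ℕ[ l < B ] boxSum n B (F k l) ≈ 0#
    row≈0 k k≢a = ≈-trans (∑ℕ-cong B λ l _ → boxSum-zero n B λ i j → f≈0 (k ∷ i) (l ∷ j) (inj₁ (k≢a ∘ ∷-injectiveˡ)))
                          (∑ℕ-zero B)
    column≈0 : ∀ l → l ≢ b → boxSum n B (F a l) ≈ 0#
    column≈0 l l≢b = boxSum-zero n B λ i j → f≈0 (a ∷ i) (l ∷ j) (inj₂ (l≢b ∘ ∷-injectiveˡ))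
    tails≈0 : ∀ i j → i ≢ i₀ ⊎ j ≢ j₀ → F a b i j ≈ 0#
    tails≈0 i j (inj₁ i≢i₀) = f≈0 (a ∷ i) (b ∷ j) (inj₁ (i≢i₀ ∘ ∷-injectiveʳ))
    tails≈0 i j (inj₂ j≢j₀) = f≈0 (a ∷ i) (b ∷ j) (inj₂ (j≢j₀ ∘ ∷-injectiveʳ))

-- Root counting

module PolynomialRoots {c ℓ} (R : CommutativeRing c ℓ)
  (*-cancelˡ-nonZero : AlmostLeftCancellative (CommutativeRing._≈_ R) (CommutativeRing.0# R) (CommutativeRing._*_ R)) where

  open CommutativeRing R renaming (refl to ≈-refl; sym to ≈-sym; trans to ≈-trans)
  open import Relation.Binary.Reasoning.Setoid setoid
  open import Algebra.Properties.Ring ring using (x∙y⁻¹≈ε⇒x≈y; x≈y⇒x∙y⁻¹≈ε; [y-z]x≈yx-zx)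
  open import Algebra.Definitions.RawSemiring (CommutativeSemiring.rawSemiring commutativeSemiring) using (_^_)
  open import Algebra.Properties.CommutativeSemigroup *-commutativeSemigroup using (x∙yz≈y∙xz)
  open import Algebra.Solver.Ring.NaturalCoefficients.Default commutativeSemiring
  open FiniteSums commutativeSemiring

  horner : ∀ {n} → Vec Carrier n → Carrier → Carrier
  horner []       t = 0#
  horner (c ∷ cs) t = c + t * horner cs t

  -- Synthetic division: horner (quotient r cs) is the quotient of horner (c ∷ cs) by X − r, for every c.
  quotient : ∀ {n} → Carrier → Vec Carrier n → Vec Carrier n
  quotient r []       = []
  quotient r (c ∷ cs) = horner (c ∷ cs) r ∷ quotient r cs

  -- P(t) − P(r) = (t − r) Q(t), rearranged into a semiring identity.
  horner-factor : ∀ {n} c (cs : Vec Carrier n) r t →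
                  horner (c ∷ cs) t + r * horner (quotient r cs) t ≈
                  horner (c ∷ cs) r + t * horner (quotient r cs) t
  horner-factor c []        r t =
    solve 3 (λ c r t → (c :+ t :* con 0) :+ r :* con 0 := (c :+ r :* con 0) :+ t :* con 0) ≈-refl c r t
  horner-factor c (c′ ∷ cs) r t = begin
    (c + t * p) + r * (h + t * q) ≈⟨ solve 6 (λ c r t p h q → (c :+ t :* p) :+ r :* (h :+ t :* q)
                                                           := (c :+ r :* h) :+ t :* (p :+ r :* q))
                                             ≈-refl c r t p h q ⟩
    (c + r * h) + t * (p + r * q) ≈⟨ +-congˡ (*-congˡ (horner-factor c′ cs r t)) ⟩
    (c + r * h) + t * (h + t * q) ∎
    where
    p = horner (c′ ∷ cs) t
    h = horner (c′ ∷ cs) r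
    q = horner (quotient r cs) t

  zeros⇒horner≈0 : ∀ {n} {cs : Vec Carrier n} t → VecAll.All (_≈ 0#) cs → horner cs t ≈ 0#
  zeros⇒horner≈0 t [] = ≈-refl
  zeros⇒horner≈0 {cs = c ∷ cs} t (c≈0 ∷ cs≈0) = begin
    c + t * horner cs t ≈⟨ +-cong c≈0 (*-congˡ (zeros⇒horner≈0 t cs≈0)) ⟩
    0# + t * 0#         ≈⟨ +-identityˡ (t * 0#) ⟩
    t * 0#              ≈⟨ zeroʳ t ⟩
    0#                  ∎

  root∧zeros⇒head≈0 : ∀ {n} c (cs : Vec Carrier n) r →
                      horner (c ∷ cs) r ≈ 0# → VecAll.All (_≈ 0#) cs → c ≈ 0#
  root∧zeros⇒head≈0 c cs r root cs≈0 = begin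
    c                   ≈⟨ +-identityʳ c ⟨
    c + 0#              ≈⟨ +-congˡ (zeroʳ r) ⟨
    c + r * 0#          ≈⟨ +-congˡ (*-congˡ (zeros⇒horner≈0 r cs≈0)) ⟨
    c + r * horner cs r ≈⟨ root ⟩
    0#                  ∎

  quotient-zeros⇒zeros : ∀ {n} r (cs : Vec Carrier n) → VecAll.All (_≈ 0#) (quotient r cs) → VecAll.All (_≈ 0#) cs
  quotient-zeros⇒zeros r []       []           = []
  quotient-zeros⇒zeros r (c ∷ cs) (root ∷ q≈0) = root∧zeros⇒head≈0 c cs r root cs≈0 ∷ cs≈0
    where cs≈0 = quotient-zeros⇒zeros r cs q≈0

  horner-roots⇒zeros : ∀ {n} (pts : ℕ → Carrier) → (∀ {m m′} → pts m ≈ pts m′ → m ≡ m′) →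
                       (cs : Vec Carrier n) → (∀ m → horner cs (pts m) ≈ 0#) → VecAll.All (_≈ 0#) cs
  horner-roots⇒zeros pts inj []       roots = []
  horner-roots⇒zeros pts inj (c ∷ cs) roots = root∧zeros⇒head≈0 c cs r (roots 0) cs≈0 ∷ cs≈0
    where
    r = pts 0
    quotient-roots : ∀ m → horner (quotient r cs) (pts (suc m)) ≈ 0#
    quotient-roots m = *-cancelˡ-nonZero (t - r) q 0# t-r≉0 (begin
      (t - r) * q   ≈⟨ [y-z]x≈yx-zx q t r ⟩
      t * q - r * q ≈⟨ x≈y⇒x∙y⁻¹≈ε tq≈rq ⟩
      0#            ≈⟨ zeroʳ (t - r) ⟨
      (t - r) * 0#  ∎)
      where
      t = pts (suc m)
      q = horner (quotient r cs) t
      t-r≉0 : t - r ≉ 0#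
      t-r≉0 = ℕ.1+n≢0 ∘ inj ∘ x∙y⁻¹≈ε⇒x≈y t r
      tq≈rq : t * q ≈ r * q
      tq≈rq = begin
        t * q                     ≈⟨ +-identityˡ (t * q) ⟨
        0# + t * q                ≈⟨ +-congʳ (roots 0) ⟨
        horner (c ∷ cs) r + t * q ≈⟨ horner-factor c cs r t ⟨
        horner (c ∷ cs) t + r * q ≈⟨ +-congʳ (roots (suc m)) ⟩
        0# + r * q                ≈⟨ +-identityˡ (r * q) ⟩
        r * q                     ∎
    cs≈0 = quotient-zeros⇒zeros r cs
             (horner-roots⇒zeros (pts ∘ suc) (ℕ.suc-injective ∘ inj) (quotient r cs) quotient-roots)

  horner-tabulate : ∀ N (f : ℕ → Carrier) t →
                    horner (tabulate {n = N} (f ∘ toℕ)) t ≈ ∑ℕ[ d < N ] (f d * t ^ d)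
  horner-tabulate zero    f t = ≈-refl
  horner-tabulate (suc N) f t = begin
    f 0 + t * horner (tabulate {n = N} (f ∘ suc ∘ toℕ)) t
      ≈⟨ +-cong (≈-sym (*-identityʳ (f 0))) (*-congˡ (horner-tabulate N (f ∘ suc) t)) ⟩
    f 0 * 1# + t * ∑ℕ[ d < N ] (f (suc d) * t ^ d)
      ≈⟨ +-congˡ (∑ℕ-distribˡ-* N (λ d → f (suc d) * t ^ d) t) ⟩
    f 0 * 1# + ∑ℕ[ d < N ] (t * (f (suc d) * t ^ d))
      ≈⟨ +-congˡ (∑ℕ-cong N λ d _ → x∙yz≈y∙xz t (f (suc d)) (t ^ d)) ⟩
    f 0 * 1# + ∑ℕ[ d < N ] (f (suc d) * t ^ suc d) ∎

  roots⇒coefficients≈0 : (pts : ℕ → Carrier) → (∀ {m m′} → pts m ≈ pts m′ → m ≡ m′) →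
                         ∀ N (f : ℕ → Carrier) → (∀ m → ∑ℕ[ d < N ] (f d * pts m ^ d) ≈ 0#) →
                         ∀ d → d < N → f d ≈ 0#
  roots⇒coefficients≈0 pts inj N f roots d d<N =
    subst (λ e → f e ≈ 0#) (toℕ-fromℕ< d<N) (tabulate⁻ zeros (fromℕ< d<N))
    where
    zeros = horner-roots⇒zeros pts inj (tabulate (f ∘ toℕ)) λ m → ≈-trans (horner-tabulate N f (pts m)) (roots m)

-- Rational arithmetic

ℚ-ring : AlmostCommutativeRing _ _
ℚ-ring = fromCommutativeRing ℚ.+-*-commutativeRing (λ x → dec⇒maybe (0ℚ ℚ.≟ x))

x≡q⁻¹*[q*x] : ∀ q .{{_ : ℚ.NonZero q}} x → x ≡ ℚ.1/ q ℚ.* (q ℚ.* x)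
x≡q⁻¹*[q*x] q x = begin
  x                       ≡⟨ ℚ.*-identityˡ x ⟨
  1ℚ ℚ.* x                ≡⟨ cong (ℚ._* x) (ℚ.*-inverseˡ q) ⟨
  (ℚ.1/ q ℚ.* q) ℚ.* x    ≡⟨ ℚ.*-assoc (ℚ.1/ q) q x ⟩
  ℚ.1/ q ℚ.* (q ℚ.* x)    ∎
  where open ≡-Reasoning

ℚ-*-cancelˡ : ∀ {q x y} → q ≢ 0ℚ → q ℚ.* x ≡ q ℚ.* y → x ≡ y
ℚ-*-cancelˡ {q} {x} {y} q≢0 qx≡qy =
  trans (x≡q⁻¹*[q*x] q x) (trans (cong (ℚ.1/ q ℚ.*_) qx≡qy) (sym (x≡q⁻¹*[q*x] q y)))
  where instance _ = ℚ.≢-nonZero q≢0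

x+x≡2*x : ∀ x → x ℚ.+ x ≡ (1ℚ ℚ.+ 1ℚ) ℚ.* x
x+x≡2*x = solve-∀ ℚ-ring

ℚ-square≡0⇒≡0 : ∀ a → a ℚ.* a ≡ 0ℚ → a ≡ 0ℚ
ℚ-square≡0⇒≡0 a a²≡0 with a ℚ.≟ 0ℚ
... | yes a≡0 = a≡0
... | no  a≢0 = ℚ-*-cancelˡ a≢0 (trans a²≡0 (sym (ℚ.*-zeroʳ a)))

↥[i/1] : ∀ i → ↥ (i ℚ./ 1) ≡ i
↥[i/1] i = trans (sym (ℤ.*-identityʳ _)) (subst (λ g → ↥ (i ℚ./ 1) ℤ.* g ≡ i) (gcd-zeroʳ i) (ℚ.↥-/ i 1))

↧[i/1] : ∀ i → ↧ (i ℚ./ 1) ≡ 1ℤ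
↧[i/1] i = trans (sym (ℤ.*-identityʳ _)) (subst (λ g → ↧ (i ℚ./ 1) ℤ.* g ≡ 1ℤ) (gcd-zeroʳ i) (ℚ.↧-/ i 1))

natℚ : ℕ → ℚ
natℚ m = + m ℚ./ 1

natℚ-injective : ∀ {m m′} → natℚ m ≡ natℚ m′ → m ≡ m′
natℚ-injective {m} {m′} eq = ℤ.+-injective (trans (sym (↥[i/1] (+ m))) (trans (cong ↥_ eq) (↥[i/1] (+ m′))))

-- In lowest terms q = p/d, the equation D d² = p² gives d ∣ p², so d = 1 by coprimality.
rationalSquare⇒integerSquare : ∀ {D} (q : ℚ) → q ℚ.* q ≡ D ℚ./ 1 → D ≡ ↥ q ℤ.* ↥ q
rationalSquare⇒integerSquare {D} q@(mkℚ p d-1 coprime) q²≡D = begin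
  D                        ≡⟨ ℤ.*-identityʳ D ⟨
  D ℤ.* (+ 1 ℤ.* + 1)      ≡⟨ cong (λ e → D ℤ.* (+ e ℤ.* + e)) d≡1 ⟨
  D ℤ.* (+ d ℤ.* + d)      ≡⟨ Dd²≡p² ⟩
  p ℤ.* p                  ∎
  where
  open ≡-Reasoning
  d = suc d-1
  g = gcd (p ℤ.* p) (+ d ℤ.* + d)
  g≡d² : g ≡ + d ℤ.* + d
  g≡d² = begin
    g                     ≡⟨ ℤ.*-identityˡ g ⟨
    1ℤ ℤ.* g              ≡⟨ cong (ℤ._* g) (↧[i/1] D) ⟨
    ↧ (D ℚ./ 1) ℤ.* g     ≡⟨ subst (λ r → ↧ r ℤ.* g ≡ + d ℤ.* + d) q²≡D (ℚ.↧-* q q) ⟩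
    + d ℤ.* + d           ∎
  Dd²≡p² : D ℤ.* (+ d ℤ.* + d) ≡ p ℤ.* p
  Dd²≡p² = begin
    D ℤ.* (+ d ℤ.* + d)   ≡⟨ cong (D ℤ.*_) g≡d² ⟨
    D ℤ.* g               ≡⟨ cong (ℤ._* g) (↥[i/1] D) ⟨
    ↥ (D ℚ./ 1) ℤ.* g     ≡⟨ subst (λ r → ↥ r ℤ.* g ≡ p ℤ.* p) q²≡D (ℚ.↥-* q q) ⟩
    p ℤ.* p               ∎
  d∣p² : d ∣ ∣ p ∣ ℕ.* ∣ p ∣
  d∣p² = divides (∣ D ∣ ℕ.* d) (begin
    ∣ p ∣ ℕ.* ∣ p ∣          ≡⟨ ℤ.abs-* p p ⟨
    ∣ p ℤ.* p ∣              ≡⟨ cong ∣_∣ Dd²≡p² ⟨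
    ∣ D ℤ.* (+ d ℤ.* + d) ∣  ≡⟨ ℤ.abs-* D (+ d ℤ.* + d) ⟩
    ∣ D ∣ ℕ.* (d ℕ.* d)      ≡⟨ ℕ.*-assoc ∣ D ∣ d d ⟨
    ∣ D ∣ ℕ.* d ℕ.* d        ∎)
  d≡1 : d ≡ 1
  d≡1 = Coprime.recompute coprime (Coprime.coprime-divisor (Coprime.sym (Coprime.recompute coprime)) d∣p² , ∣-refl)

∣i∣≡1⇒i*i≡1 : ∀ i → ∣ i ∣ ≡ 1 → i ℤ.* i ≡ 1ℤ
∣i∣≡1⇒i*i≡1 (+ .1)    refl = refl
∣i∣≡1⇒i*i≡1 -[1+ 0 ] refl = refl

squareFree⇒nonSquare : ∀ {D} → SquareFree D → D ≢ 1ℤ → ∀ q → q ℚ.* q ≢ D ℚ./ 1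
squareFree⇒nonSquare {D} squareFree D≢1 q q²≡D = D≢1 (trans D≡p² (∣i∣≡1⇒i*i≡1 p ∣p∣≡1))
  where
  p = ↥ q
  D≡p² = rationalSquare⇒integerSquare q q²≡D
  ∣p∣≡1 : ∣ p ∣ ≡ 1
  ∣p∣≡1 = squareFree ∣ p ∣ (∣-reflexive (trans (sym (ℤ.abs-* p p)) (cong ∣_∣ (sym D≡p²))))

-- The quadratic field

module QuadraticField (D : ℤ) where

  open Field D public
  open import Data.Rational using (_+_; _*_; -_)
  open ≡-Reasoning

  -K_ : K → K
  -K (a +√D· b) = (- a) +√D· (- b)

  K-isCommutativeRing : IsCommutativeRing _≡_ _+K_ _*K_ -K_ 0K 1K
  K-isCommutativeRing = record
    { isRing = record
      { +-isAbelianGroup = record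
        { isGroup = record
          { isMonoid = record
            { isSemigroup = record
              { isMagma = record { isEquivalence = isEquivalence ; ∙-cong = cong₂ _+K_ }
              ; assoc   = +-assoc }
            ; identity = +-identityˡ , +-identityʳ }
          ; inverse = +-inverseˡ , +-inverseʳ
          ; ⁻¹-cong = cong -K_ }
        ; comm = +-comm }
      ; *-cong     = cong₂ _*K_
      ; *-assoc    = *-assoc
      ; *-identity = *-identityˡ , *-identityʳ
      ; distrib    = distribˡ , distribʳ }
    ; *-comm = *-comm }
    where
    +-assoc : ∀ x y z → (x +K y) +K z ≡ x +K (y +K z)
    +-assoc (a +√D· b) (c +√D· d) (e +√D· f) = cong₂ _+√D·_ (ℚ.+-assoc a c e) (ℚ.+-assoc b d f)
    +-comm : ∀ x y → x +K y ≡ y +K x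
    +-comm (a +√D· b) (c +√D· d) = cong₂ _+√D·_ (ℚ.+-comm a c) (ℚ.+-comm b d)
    +-identityˡ : ∀ x → 0K +K x ≡ x
    +-identityˡ (a +√D· b) = cong₂ _+√D·_ (ℚ.+-identityˡ a) (ℚ.+-identityˡ b)
    +-identityʳ : ∀ x → x +K 0K ≡ x
    +-identityʳ (a +√D· b) = cong₂ _+√D·_ (ℚ.+-identityʳ a) (ℚ.+-identityʳ b)
    +-inverseˡ : ∀ x → (-K x) +K x ≡ 0K
    +-inverseˡ (a +√D· b) = cong₂ _+√D·_ (ℚ.+-inverseˡ a) (ℚ.+-inverseˡ b)
    +-inverseʳ : ∀ x → x +K (-K x) ≡ 0K
    +-inverseʳ (a +√D· b) = cong₂ _+√D·_ (ℚ.+-inverseʳ a) (ℚ.+-inverseʳ b)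
    *-comm : ∀ x y → x *K y ≡ y *K x
    *-comm (a +√D· b) (c +√D· d) = cong₂ _+√D·_ (re-comm Dℚ a b c d) (im-comm a b c d)
      where
      re-comm : ∀ D a b c d → a * c + D * (b * d) ≡ c * a + D * (d * b)
      re-comm = solve-∀ ℚ-ring
      im-comm : ∀ a b c d → a * d + b * c ≡ c * b + d * a
      im-comm = solve-∀ ℚ-ring
    *-assoc : ∀ x y z → (x *K y) *K z ≡ x *K (y *K z)
    *-assoc (a +√D· b) (c +√D· d) (e +√D· f) = cong₂ _+√D·_ (re-assoc Dℚ a b c d e f) (im-assoc Dℚ a b c d e f)
      where
      re-assoc : ∀ D a b c d e f → (a * c + D * (b * d)) * e + D * ((a * d + b * c) * f)
                                 ≡ a * (c * e + D * (d * f)) + D * (b * (c * f + d * e))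
      re-assoc = solve-∀ ℚ-ring
      im-assoc : ∀ D a b c d e f → (a * c + D * (b * d)) * f + (a * d + b * c) * e
                                 ≡ a * (c * f + d * e) + b * (c * e + D * (d * f))
      im-assoc = solve-∀ ℚ-ring
    *-identityʳ : ∀ x → x *K 1K ≡ x
    *-identityʳ (a +√D· b) = cong₂ _+√D·_ (re-identity Dℚ a b) (im-identity a b)
      where
      re-identity : ∀ D a b → a * 1ℚ + D * (b * 0ℚ) ≡ a
      re-identity = solve-∀ ℚ-ring
      im-identity : ∀ a b → a * 0ℚ + b * 1ℚ ≡ b
      im-identity = solve-∀ ℚ-ring
    *-identityˡ : ∀ x → 1K *K x ≡ x
    *-identityˡ x = trans (*-comm 1K x) (*-identityʳ x)
    distribˡ : ∀ x y z → x *K (y +K z) ≡ (x *K y) +K (x *K z)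
    distribˡ (a +√D· b) (c +√D· d) (e +√D· f) = cong₂ _+√D·_ (re-distrib Dℚ a b c d e f) (im-distrib a b c d e f)
      where
      re-distrib : ∀ D a b c d e f → a * (c + e) + D * (b * (d + f)) ≡ (a * c + D * (b * d)) + (a * e + D * (b * f))
      re-distrib = solve-∀ ℚ-ring
      im-distrib : ∀ a b c d e f → a * (d + f) + b * (c + e) ≡ (a * d + b * c) + (a * f + b * e)
      im-distrib = solve-∀ ℚ-ring
    distribʳ : ∀ x y z → (y +K z) *K x ≡ (y *K x) +K (z *K x)
    distribʳ x y z = trans (*-comm (y +K z) x) (trans (distribˡ x y z) (cong₂ _+K_ (*-comm x y) (*-comm x z)))

  K-commutativeRing : CommutativeRing _ _
  K-commutativeRing = record { isCommutativeRing = K-isCommutativeRing }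

  module KR = CommutativeRing K-commutativeRing
  open import Algebra.Definitions.RawSemiring (CommutativeSemiring.rawSemiring KR.commutativeSemiring) public using (_^_)
  open import Algebra.Properties.CommutativeSemigroup KR.*-commutativeSemigroup using (xy∙z≈y∙xz)

  ^K≡^ : ∀ x n → x ^K n ≡ x ^ n
  ^K≡^ x zero    = refl
  ^K≡^ x (suc n) = cong (x *K_) (^K≡^ x n)

  τ-homo-* : ∀ x y → τ (x *K y) ≡ τ x *K τ y
  τ-homo-* (a +√D· b) (c +√D· d) = cong₂ _+√D·_ (re-τ Dℚ a b c d) (im-τ a b c d)
    where
    re-τ : ∀ D a b c d → a * c + D * (b * d) ≡ a * c + D * ((- b) * (- d))
    re-τ = solve-∀ ℚ-ring
    im-τ : ∀ a b c d → - (a * d + b * c) ≡ a * (- d) + (- b) * c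
    im-τ = solve-∀ ℚ-ring

  ι-homo-* : ∀ p q → ι p *K ι q ≡ ι (p * q)
  ι-homo-* p q = cong₂ _+√D·_ (re-ι Dℚ p q) (im-ι p q)
    where
    re-ι : ∀ D p q → p * q + D * (0ℚ * 0ℚ) ≡ p * q
    re-ι = solve-∀ ℚ-ring
    im-ι : ∀ p q → p * 0ℚ + 0ℚ * q ≡ 0ℚ
    im-ι = solve-∀ ℚ-ring

  ι-*K : ∀ q x → ι q *K x ≡ (q * re x) +√D· (q * im x)
  ι-*K q (a +√D· b) = cong₂ _+√D·_ (re-scale Dℚ q a b) (im-scale q a b)
    where
    re-scale : ∀ D q a b → q * a + D * (0ℚ * b) ≡ q * a
    re-scale = solve-∀ ℚ-ring
    im-scale : ∀ q a b → q * b + 0ℚ * a ≡ q * b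
    im-scale = solve-∀ ℚ-ring

  ι-*K-rational : ∀ q x → im x ≡ 0ℚ → ι q *K x ≡ ι (q * re x)
  ι-*K-rational q x im≡0 = trans (ι-*K q x) (cong ((q * re x) +√D·_) (trans (cong (q *_) im≡0) (ℚ.*-zeroʳ q)))

  norm : K → ℚ
  norm x = re (x *K τ x)

  *-τ≡ι-norm : ∀ x → x *K τ x ≡ ι (norm x)
  *-τ≡ι-norm (a +√D· b) = cong ((a * a + Dℚ * (b * (- b))) +√D·_) (im-norm a b)
    where
    im-norm : ∀ a b → a * (- b) + b * a ≡ 0ℚ
    im-norm = solve-∀ ℚ-ring

  norm≡0⇒a²≡Db² : ∀ a b → norm (a +√D· b) ≡ 0ℚ → a * a ≡ Dℚ * (b * b)
  norm≡0⇒a²≡Db² a b N≡0 = trans (split Dℚ a b) (trans (cong (_+ Dℚ * (b * b)) N≡0) (ℚ.+-identityˡ _))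
    where
    split : ∀ D a b → a * a ≡ (a * a + D * (b * (- b))) + D * (b * b)
    split = solve-∀ ℚ-ring

  module _ (nonSquare : ∀ q → q * q ≢ Dℚ) where

    norm≡0⇒≡0K : ∀ x → norm x ≡ 0ℚ → x ≡ 0K
    norm≡0⇒≡0K (a +√D· b) N≡0 with b ℚ.≟ 0ℚ
    ... | yes refl = cong (_+√D· 0ℚ) (ℚ-square≡0⇒≡0 a (trans (norm≡0⇒a²≡Db² a 0ℚ N≡0) (zero-square Dℚ)))
      where
      zero-square : ∀ D → D * (0ℚ * 0ℚ) ≡ 0ℚ
      zero-square = solve-∀ ℚ-ring
    ... | no  b≢0  = contradiction [a/b]²≡D (nonSquare (a * c))
      where
      instance _ = ℚ.≢-nonZero b≢0
      c = ℚ.1/ b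
      square-* : ∀ a c → (a * c) * (a * c) ≡ (a * a) * (c * c)
      square-* = solve-∀ ℚ-ring
      regroup : ∀ D b c → (D * (b * b)) * (c * c) ≡ D * ((b * c) * (b * c))
      regroup = solve-∀ ℚ-ring
      [a/b]²≡D : (a * c) * (a * c) ≡ Dℚ
      [a/b]²≡D = begin
        (a * c) * (a * c)        ≡⟨ square-* a c ⟩
        (a * a) * (c * c)        ≡⟨ cong (_* (c * c)) (norm≡0⇒a²≡Db² a b N≡0) ⟩
        (Dℚ * (b * b)) * (c * c) ≡⟨ regroup Dℚ b c ⟩
        Dℚ * ((b * c) * (b * c)) ≡⟨ cong (λ e → Dℚ * (e * e)) (ℚ.*-inverseʳ b) ⟩
        Dℚ * (1ℚ * 1ℚ)           ≡⟨ ℚ.*-identityʳ Dℚ ⟩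
        Dℚ                       ∎

    -- Multiplying by τ x replaces x by its norm, a nonzero rational.
    *K-cancelˡ-nonZero : AlmostLeftCancellative _≡_ 0K _*K_
    *K-cancelˡ-nonZero x y z x≢0 xy≡xz =
      cong₂ _+√D·_ (ℚ-*-cancelˡ N≢0 (cong re scaled)) (ℚ-*-cancelˡ N≢0 (cong im scaled))
      where
      N = norm x
      N≢0 : N ≢ 0ℚ
      N≢0 = x≢0 ∘ norm≡0⇒≡0K x
      ι-norm-* : ∀ w → (N * re w) +√D· (N * im w) ≡ τ x *K (x *K w)
      ι-norm-* w = begin
        (N * re w) +√D· (N * im w) ≡⟨ ι-*K N w ⟨
        ι N *K w                   ≡⟨ cong (_*K w) (*-τ≡ι-norm x) ⟨
        (x *K τ x) *K w            ≡⟨ xy∙z≈y∙xz x (τ x) w ⟩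
        τ x *K (x *K w)            ∎
      scaled : (N * re y) +√D· (N * im y) ≡ (N * re z) +√D· (N * im z)
      scaled = trans (ι-norm-* y) (trans (cong (τ x *K_) xy≡xz) (sym (ι-norm-* z)))

-- Generalized polynomials as functions

module GeneralizedPolynomials (D : ℤ) where

  open QuadraticField D
  open FiniteSums KR.commutativeSemiring
  open ≡-Reasoning
  open import Algebra.Properties.Semiring.Exp KR.semiring using (^-homo-*)
  open import Algebra.Solver.Ring.NaturalCoefficients.Default KR.commutativeSemiring

  ^K-homo-+ : ∀ x m n → x ^K (m ℕ.+ n) ≡ (x ^K m) *K (x ^K n)
  ^K-homo-+ x m n = begin
    x ^K (m ℕ.+ n)        ≡⟨ ^K≡^ x (m ℕ.+ n) ⟩
    x ^ (m ℕ.+ n)         ≡⟨ ^-homo-* x m n ⟩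
    (x ^ m) *K (x ^ n)    ≡⟨ cong₂ _*K_ (^K≡^ x m) (^K≡^ x n) ⟨
    (x ^K m) *K (x ^K n)  ∎

  eval-++ : ∀ {n} (p q : GPoly n) a → eval (p ++ q) a ≡ eval p a +K eval q a
  eval-++ []                q a = sym (KR.+-identityˡ (eval q a))
  eval-++ ((α , i , j) ∷ p) q a = trans (cong (αm +K_) (eval-++ p q a)) (sym (KR.+-assoc αm (eval p a) (eval q a)))
    where αm = α *K monoEval a i j

  monoEval-+ : ∀ {n} (a : Vec K n) i j i′ j′ →
               monoEval a (zipWith ℕ._+_ i i′) (zipWith ℕ._+_ j j′) ≡ monoEval a i j *K monoEval a i′ j′
  monoEval-+ []       []      []      []        []        = sym (KR.*-identityˡ 1K)
  monoEval-+ (x ∷ a) (k ∷ i) (l ∷ j) (k′ ∷ i′) (l′ ∷ j′) = begin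
    ((x ^K (k ℕ.+ k′)) *K (τ x ^K (l ℕ.+ l′))) *K monoEval a (zipWith ℕ._+_ i i′) (zipWith ℕ._+_ j j′)
      ≡⟨ cong₂ _*K_ (cong₂ _*K_ (^K-homo-+ x k k′) (^K-homo-+ (τ x) l l′)) (monoEval-+ a i j i′ j′) ⟩
    (((x ^K k) *K (x ^K k′)) *K ((τ x ^K l) *K (τ x ^K l′))) *K (monoEval a i j *K monoEval a i′ j′)
      ≡⟨ solve 6 (λ a b c d m m′ → ((a :* b) :* (c :* d)) :* (m :* m′) := ((a :* c) :* m) :* ((b :* d) :* m′))
               refl (x ^K k) (x ^K k′) (τ x ^K l) (τ x ^K l′) (monoEval a i j) (monoEval a i′ j′) ⟩
    (((x ^K k) *K (τ x ^K l)) *K monoEval a i j) *K (((x ^K k′) *K (τ x ^K l′)) *K monoEval a i′ j′) ∎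

  mulTerm : ∀ {n} → Term n → Term n → Term n
  mulTerm (α , i , j) (β , i′ , j′) = (α *K β , zipWith ℕ._+_ i i′ , zipWith ℕ._+_ j j′)

  eval-map-mulTerm : ∀ {n} α (i j : Vec ℕ n) q a →
                     eval (map (mulTerm (α , i , j)) q) a ≡ (α *K monoEval a i j) *K eval q a
  eval-map-mulTerm α i j []                   a = sym (KR.zeroʳ (α *K monoEval a i j))
  eval-map-mulTerm α i j ((β , i′ , j′) ∷ q) a = begin
    ((α *K β) *K monoEval a (zipWith ℕ._+_ i i′) (zipWith ℕ._+_ j j′)) +K eval (map (mulTerm (α , i , j)) q) a
      ≡⟨ cong₂ _+K_ (cong ((α *K β) *K_) (monoEval-+ a i j i′ j′)) (eval-map-mulTerm α i j q a) ⟩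
    ((α *K β) *K (m *K m′)) +K ((α *K m) *K eval q a)
      ≡⟨ solve 5 (λ α β m m′ e → (α :* β) :* (m :* m′) :+ (α :* m) :* e := (α :* m) :* (β :* m′ :+ e))
                 refl α β m m′ (eval q a) ⟩
    (α *K m) *K ((β *K m′) +K eval q a) ∎
    where
    m  = monoEval a i j
    m′ = monoEval a i′ j′

  eval-*P : ∀ {n} (p q : GPoly n) a → eval (p *P q) a ≡ eval p a *K eval q a
  eval-*P []                q a = sym (KR.zeroˡ (eval q a))
  eval-*P ((α , i , j) ∷ p) q a = begin
    eval (map (mulTerm (α , i , j)) q ++ (p *P q)) a
      ≡⟨ eval-++ (map (mulTerm (α , i , j)) q) (p *P q) a ⟩
    eval (map (mulTerm (α , i , j)) q) a +K eval (p *P q) a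
      ≡⟨ cong₂ _+K_ (eval-map-mulTerm α i j q a) (eval-*P p q a) ⟩
    ((α *K monoEval a i j) *K eval q a) +K (eval p a *K eval q a)
      ≡⟨ KR.distribʳ (eval q a) (α *K monoEval a i j) (eval p a) ⟨
    ((α *K monoEval a i j) +K eval p a) *K eval q a ∎

  monoEval-0 : ∀ {n} (a : Vec K n) → monoEval a (replicate n 0) (replicate n 0) ≡ 1K
  monoEval-0 []      = refl
  monoEval-0 (x ∷ a) = trans (cong ((1K *K 1K) *K_) (monoEval-0 a)) (trans (KR.*-identityʳ (1K *K 1K)) (KR.*-identityʳ 1K))

  eval-constP : ∀ {n} α (a : Vec K n) → eval (constP α) a ≡ α
  eval-constP {n} α a = begin
    (α *K monoEval a (replicate n 0) (replicate n 0)) +K 0K ≡⟨ KR.+-identityʳ _ ⟩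
    α *K monoEval a (replicate n 0) (replicate n 0)         ≡⟨ cong (α *K_) (monoEval-0 a) ⟩
    α *K 1K                                                 ≡⟨ KR.*-identityʳ α ⟩
    α                                                       ∎

  monoEval-z : ∀ {n} (a : Vec K n) k → monoEval a (replicate n 0 [ k ]≔ 1) (replicate n 0) ≡ lookup a k
  monoEval-z (x ∷ a) zero    = trans (cong (((x *K 1K) *K 1K) *K_) (monoEval-0 a))
                                     (solve 1 (λ x → ((x :* con 1) :* con 1) :* con 1 := x) refl x)
  monoEval-z (x ∷ a) (suc k) = trans (cong ((1K *K 1K) *K_) (monoEval-z a k))
                                     (solve 1 (λ y → (con 1 :* con 1) :* y := y) refl (lookup a k))

  monoEval-τz : ∀ {n} (a : Vec K n) k → monoEval a (replicate n 0) (replicate n 0 [ k ]≔ 1) ≡ τ (lookup a k)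
  monoEval-τz (x ∷ a) zero    = trans (cong ((1K *K (τ x *K 1K)) *K_) (monoEval-0 a))
                                      (solve 1 (λ x → (con 1 :* (x :* con 1)) :* con 1 := x) refl (τ x))
  monoEval-τz (x ∷ a) (suc k) = trans (cong ((1K *K 1K) *K_) (monoEval-τz a k))
                                      (solve 1 (λ y → (con 1 :* con 1) :* y := y) refl (τ (lookup a k)))

  eval-zP : ∀ {n} (k : Fin n) a → eval (zP k) a ≡ lookup a k
  eval-zP k a = trans (KR.+-identityʳ _) (trans (KR.*-identityˡ _) (monoEval-z a k))

  eval-τzP : ∀ {n} (k : Fin n) a → eval (τzP k) a ≡ τ (lookup a k)
  eval-τzP k a = trans (KR.+-identityʳ _) (trans (KR.*-identityˡ _) (monoEval-τz a k))

  Bounded : ∀ {n} → ℕ → GPoly n → Set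
  Bounded B = ListAll.All (λ (_ , i , j) → InBox B i × InBox B j)

  InBox-mono : ∀ {n B B′} → B ℕ.≤ B′ → {v : Vec ℕ n} → InBox B v → InBox B′ v
  InBox-mono B≤B′ = VecAll.map (λ x<B → ℕ.<-≤-trans x<B B≤B′)

  inSomeBox : ∀ {n} (v : Vec ℕ n) → ∃ λ B → InBox B v
  inSomeBox []      = 0 , []
  inSomeBox (x ∷ v) with inSomeBox v
  ... | B , v∈B = suc x ℕ.⊔ B , ℕ.m≤m⊔n (suc x) B ∷ InBox-mono (ℕ.m≤n⊔m (suc x) B) v∈B

  bounded : ∀ {n} (p : GPoly n) → ∃ λ B → Bounded B p
  bounded []                = 0 , []
  bounded ((α , i , j) ∷ p) with bounded p | inSomeBox i | inSomeBox j
  ... | B , p∈B | Bi , i∈Bi | Bj , j∈Bj =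
    B ℕ.⊔ (Bi ℕ.⊔ Bj) ,
    (InBox-mono (ℕ.≤-trans (ℕ.m≤m⊔n Bi Bj) B≤) i∈Bi , InBox-mono (ℕ.≤-trans (ℕ.m≤n⊔m Bi Bj) B≤) j∈Bj)
    ∷ ListAll.map (λ (i∈B , j∈B) → InBox-mono (ℕ.m≤m⊔n B _) i∈B , InBox-mono (ℕ.m≤m⊔n B _) j∈B) p∈B
    where B≤ = ℕ.m≤n⊔m B (Bi ℕ.⊔ Bj)

  bounded₂ : ∀ {n} (p q : GPoly n) → ∃ λ B → Bounded B p × Bounded B q
  bounded₂ p q with bounded (p ++ q)
  ... | B , p++q∈B = B , ListAllₚ.++⁻ p p++q∈B

  coeff-∷ : ∀ {n} (t : Term n) p i j → coeff (t ∷ p) i j ≡ coeff (t ∷ []) i j +K coeff p i j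
  coeff-∷ (α , i′ , j′) p i j with ≡-dec ℕ._≟_ i i′ | ≡-dec ℕ._≟_ j j′
  ... | yes _ | yes _ = cong (_+K coeff p i j) (sym (KR.+-identityʳ α))
  ... | yes _ | no  _ = sym (KR.+-identityˡ (coeff p i j))
  ... | no  _ | _     = sym (KR.+-identityˡ (coeff p i j))

  coeff-single-≡ : ∀ {n} α (i j : Vec ℕ n) → coeff ((α , i , j) ∷ []) i j ≡ α
  coeff-single-≡ α i j with ≡-dec ℕ._≟_ i i | ≡-dec ℕ._≟_ j j
  ... | yes _ | yes _ = KR.+-identityʳ α
  ... | yes _ | no j≢j = contradiction refl j≢j
  ... | no i≢i | _    = contradiction refl i≢i

  coeff-single-≢ : ∀ {n} α (i₀ j₀ i j : Vec ℕ n) → i ≢ i₀ ⊎ j ≢ j₀ → coeff ((α , i₀ , j₀) ∷ []) i j ≡ 0K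
  coeff-single-≢ α i₀ j₀ i j ≢₀ with ≡-dec ℕ._≟_ i i₀ | ≡-dec ℕ._≟_ j j₀ | ≢₀
  ... | yes i≡i₀ | yes _    | inj₁ i≢i₀ = contradiction i≡i₀ i≢i₀
  ... | yes _    | yes j≡j₀ | inj₂ j≢j₀ = contradiction j≡j₀ j≢j₀
  ... | yes _    | no  _    | _         = refl
  ... | no  _    | _        | _         = refl

  coeffSum : ∀ {n} → ℕ → GPoly n → Vec K n → K
  coeffSum {n} B p a = boxSum n B (λ i j → coeff p i j *K monoEval a i j)

  eval≡coeffSum : ∀ {n} B (p : GPoly n) a → Bounded B p → eval p a ≡ coeffSum B p a
  eval≡coeffSum {n} B []                  a []                       =
    sym (boxSum-zero n B λ i j → KR.zeroˡ (monoEval a i j))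
  eval≡coeffSum {n} B ((α , i₀ , j₀) ∷ p) a ((i₀∈B , j₀∈B) ∷ p∈B) = begin
    (α *K monoEval a i₀ j₀) +K eval p a
      ≡⟨ cong₂ _+K_ (sym head-sum) (eval≡coeffSum B p a p∈B) ⟩
    coeffSum B (t ∷ []) a +K coeffSum B p a
      ≡⟨ boxSum-distrib-+ n B _ _ ⟨
    boxSum n B (λ i j → (coeff (t ∷ []) i j *K monoEval a i j) +K (coeff p i j *K monoEval a i j))
      ≡⟨ boxSum-cong n B (λ i j → trans (sym (KR.distribʳ (monoEval a i j) (coeff (t ∷ []) i j) (coeff p i j)))
                                        (cong (_*K monoEval a i j) (sym (coeff-∷ t p i j)))) ⟩
    coeffSum B (t ∷ p) a ∎
    where
    t = (α , i₀ , j₀)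
    head-sum : coeffSum B (t ∷ []) a ≡ α *K monoEval a i₀ j₀
    head-sum = trans (boxSum-single _ i₀∈B j₀∈B λ i j ≢₀ → trans (cong (_*K monoEval a i j) (coeff-single-≢ α i₀ j₀ i j ≢₀))
                                                                 (KR.zeroˡ (monoEval a i j)))
                     (cong (_*K monoEval a i₀ j₀) (coeff-single-≡ α i₀ j₀))

  coeff-outside : ∀ {n} B (p : GPoly n) i j → Bounded B p → ¬ (InBox B i × InBox B j) → coeff p i j ≡ 0K
  coeff-outside B []                i j []                    _   = refl
  coeff-outside B ((α , i₀ , j₀) ∷ p) i j ((i₀∈B , j₀∈B) ∷ p∈B) out = begin
    coeff ((α , i₀ , j₀) ∷ p) i j                    ≡⟨ coeff-∷ (α , i₀ , j₀) p i j ⟩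
    coeff ((α , i₀ , j₀) ∷ []) i j +K coeff p i j    ≡⟨ cong₂ _+K_ (coeff-single-≢ α i₀ j₀ i j ≢₀)
                                                                   (coeff-outside B p i j p∈B out) ⟩
    0K +K 0K                                        ≡⟨ KR.+-identityʳ 0K ⟩
    0K                                              ∎
    where
    ≢₀ : i ≢ i₀ ⊎ j ≢ j₀
    ≢₀ with ≡-dec ℕ._≟_ i i₀
    ... | yes refl = inj₂ λ { refl → out (i₀∈B , j₀∈B) }
    ... | no  i≢i₀ = inj₁ i≢i₀

  ≈P⇒eval≡ : ∀ {n} (p q : GPoly n) → p ≈P q → ∀ a → eval p a ≡ eval q a
  ≈P⇒eval≡ {n} p q p≈q a with bounded₂ p q
  ... | B , p∈B , q∈B = begin
    eval p a       ≡⟨ eval≡coeffSum B p a p∈B ⟩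
    coeffSum B p a ≡⟨ boxSum-cong n B (λ i j → cong (_*K monoEval a i j) (p≈q i j)) ⟩
    coeffSum B q a ≡⟨ eval≡coeffSum B q a q∈B ⟨
    eval q a       ∎

-- The identity theorem

module IdentityTheorem (D : ℤ) (nonSquare : ∀ q → q ℚ.* q ≢ Field.Dℚ D) where

  open QuadraticField D
  open GeneralizedPolynomials D
  open FiniteSums KR.commutativeSemiring
  open PolynomialRoots K-commutativeRing (*K-cancelˡ-nonZero nonSquare)
  open import Algebra.Properties.Semiring.Exp KR.semiring using (^-homo-*)
  open import Algebra.Properties.CommutativeSemiring.Exp KR.commutativeSemiring using (^-distrib-*)
  open import Algebra.Solver.Ring.NaturalCoefficients.Default KR.commutativeSemiring
  open import Algebra.Properties.CommutativeSemigroup KR.*-commutativeSemigroup using (x∙yz≈y∙xz; xy∙z≈xz∙y; xy∙z≈x∙zy)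
  open import Algebra.Properties.Ring KR.ring using (x∙y⁻¹≈ε⇒x≈y; +-identityˡ-unique; //-rightDividesˡ)
  open ≡-Reasoning

  σ : ℕ → K
  σ m = natℚ m +√D· 1ℚ

  norm-σ≢0 : ∀ m → norm (σ m) ≢ 0ℚ
  norm-σ≢0 m N≡0 = ℚ.1≢0 (cong im (norm≡0⇒≡0K nonSquare (σ m) N≡0))

  -- ω m = σ m / τ (σ m)
  ω : ℕ → K
  ω m = (σ m *K σ m) *K ι (ℚ.1/ norm (σ m))
    where instance _ = ℚ.≢-nonZero (norm-σ≢0 m)

  ω-*-τσ : ∀ m → ω m *K τ (σ m) ≡ σ m
  ω-*-τσ m = begin
    ((s *K s) *K ι c) *K τ s   ≡⟨ solve 3 (λ s c t → ((s :* s) :* c) :* t := s :* ((s :* t) :* c)) refl s (ι c) (τ s) ⟩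
    s *K ((s *K τ s) *K ι c)   ≡⟨ cong (λ z → s *K (z *K ι c)) (*-τ≡ι-norm s) ⟩
    s *K (ι N *K ι c)          ≡⟨ cong (s *K_) (ι-homo-* N c) ⟩
    s *K ι (N ℚ.* c)           ≡⟨ cong (λ z → s *K ι z) (ℚ.*-inverseʳ N) ⟩
    s *K 1K                    ≡⟨ KR.*-identityʳ s ⟩
    s                          ∎
    where
    s = σ m
    N = norm s
    instance _ = ℚ.≢-nonZero (norm-σ≢0 m)
    c = ℚ.1/ N

  -- The imaginary parts of σ m τ(σ m′) = σ m′ τ(σ m) are m′ − m and m − m′.
  ω-injective : ∀ {m m′} → ω m ≡ ω m′ → m ≡ m′
  ω-injective {m} {m′} ωm≡ωm′ = natℚ-injective (cross-im-injective (natℚ m) (natℚ m′) (cong im cross))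
    where
    cross : σ m *K τ (σ m′) ≡ σ m′ *K τ (σ m)
    cross = begin
      σ m *K τ (σ m′)                   ≡⟨ cong (_*K τ (σ m′)) (ω-*-τσ m) ⟨
      (ω m *K τ (σ m)) *K τ (σ m′)      ≡⟨ cong (λ z → (z *K τ (σ m)) *K τ (σ m′)) ωm≡ωm′ ⟩
      (ω m′ *K τ (σ m)) *K τ (σ m′)     ≡⟨ xy∙z≈xz∙y (ω m′) (τ (σ m)) (τ (σ m′)) ⟩
      (ω m′ *K τ (σ m′)) *K τ (σ m)     ≡⟨ cong (_*K τ (σ m)) (ω-*-τσ m′) ⟩
      σ m′ *K τ (σ m)                   ∎
    cross-im-injective : ∀ x y → x ℚ.* (ℚ.- 1ℚ) ℚ.+ 1ℚ ℚ.* y ≡ y ℚ.* (ℚ.- 1ℚ) ℚ.+ 1ℚ ℚ.* x → x ≡ y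
    cross-im-injective x y eq = ℚ-*-cancelˡ {1ℚ ℚ.+ 1ℚ} (λ ()) (begin
      (1ℚ ℚ.+ 1ℚ) ℚ.* x                 ≡⟨ expand x y ⟩
      (B ℚ.- A) ℚ.+ (1ℚ ℚ.+ 1ℚ) ℚ.* y   ≡⟨ cong (λ b → (b ℚ.- A) ℚ.+ (1ℚ ℚ.+ 1ℚ) ℚ.* y) eq ⟨
      (A ℚ.- A) ℚ.+ (1ℚ ℚ.+ 1ℚ) ℚ.* y   ≡⟨ cancel A y ⟩
      (1ℚ ℚ.+ 1ℚ) ℚ.* y                 ∎)
      where
      open import Data.Rational using (_+_; _-_; _*_; -_)
      A = x * (- 1ℚ) + 1ℚ * y
      B = y * (- 1ℚ) + 1ℚ * x
      expand : ∀ x y → (1ℚ + 1ℚ) * x ≡ ((y * (- 1ℚ) + 1ℚ * x) - (x * (- 1ℚ) + 1ℚ * y)) + (1ℚ + 1ℚ) * y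
      expand = solve-∀ ℚ-ring
      cancel : ∀ a y → (a - a) + (1ℚ + 1ℚ) * y ≡ (1ℚ + 1ℚ) * y
      cancel = solve-∀ ℚ-ring

  monomial-factor : ∀ a w k l → a ≡ w *K τ a → (a ^K k) *K (τ a ^K l) ≡ (w ^ k) *K (τ a ^ (k ℕ.+ l))
  monomial-factor a w k l a≡wτa = begin
    (a ^K k) *K (τ a ^K l)               ≡⟨ cong₂ _*K_ (^K≡^ a k) (^K≡^ (τ a) l) ⟩
    (a ^ k) *K (τ a ^ l)                 ≡⟨ cong (λ z → (z ^ k) *K (τ a ^ l)) a≡wτa ⟩
    ((w *K τ a) ^ k) *K (τ a ^ l)        ≡⟨ cong (_*K (τ a ^ l)) (^-distrib-* w (τ a) k) ⟩
    ((w ^ k) *K (τ a ^ k)) *K (τ a ^ l)  ≡⟨ KR.*-assoc (w ^ k) (τ a ^ k) (τ a ^ l) ⟩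
    (w ^ k) *K ((τ a ^ k) *K (τ a ^ l))  ≡⟨ cong ((w ^ k) *K_) (^-homo-* (τ a) k l) ⟨
    (w ^ k) *K (τ a ^ (k ℕ.+ l))         ∎

  point : ℕ → ℕ → K
  point m t = ι (natℚ t) *K σ m

  point≡ω*τpoint : ∀ m t → point m t ≡ ω m *K τ (point m t)
  point≡ω*τpoint m t = begin
    ι q *K σ m                  ≡⟨ cong (ι q *K_) (ω-*-τσ m) ⟨
    ι q *K (ω m *K τ (σ m))     ≡⟨ x∙yz≈y∙xz (ι q) (ω m) (τ (σ m)) ⟩
    ω m *K (ι q *K τ (σ m))     ≡⟨ cong (ω m *K_) (τ-homo-* (ι q) (σ m)) ⟨
    ω m *K τ (ι q *K σ m)       ∎
    where q = natℚ t

  τpoint-injective : ∀ m {t t′} → τ (point m t) ≡ τ (point m t′) → t ≡ t′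
  τpoint-injective m {t} {t′} eq = natℚ-injective (ℚ.neg-injective (trans (sym (im-τpoint t)) (trans (cong im eq) (im-τpoint t′))))
    where
    im-τpoint : ∀ t → im (τ (point m t)) ≡ ℚ.- natℚ t
    im-τpoint t = trans (cong im (τ-homo-* (ι (natℚ t)) (σ m))) (im-scale (natℚ t) (natℚ m))
      where
      open import Data.Rational using (_+_; _*_; -_)
      im-scale : ∀ q r → q * (- 1ℚ) + 0ℚ * r ≡ - q
      im-scale = solve-∀ ℚ-ring

  -- Along a = t σ m we have a = ω m τ a, so the sum is a polynomial in τ a = t τ(σ m) whose
  -- coefficient of degree d is ∑ₖ e d k (ω m)^k.  Root counting in t and then in ω m kills
  -- every e d k, and c k l = e (k + l) k.
  vanishing₁⇒coefficients≡0 : ∀ B (c : ℕ → ℕ → K) →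
                              (∀ a → ∑ℕ[ k < B ] ∑ℕ[ l < B ] (c k l *K ((a ^K k) *K (τ a ^K l))) ≡ 0K) →
                              ∀ {k l} → k < B → l < B → c k l ≡ 0K
  vanishing₁⇒coefficients≡0 B c vanish {k} {l} k<B l<B = begin
    c k l                         ≡⟨ δ-refl (k ℕ.+ l) (c k l) ⟨
    δ (k ℕ.+ l) (k ℕ.+ l) (c k l) ≡⟨ ∑ℕ-single (λ l′ → δ (k ℕ.+ l) (k ℕ.+ l′) (c k l′)) l<B off-diagonal ⟨
    e (k ℕ.+ l) k                 ≡⟨ e≡0 (k ℕ.+ l) (ℕ.+-mono-< k<B l<B) k k<B ⟩
    0K                            ∎
    where
    e : ℕ → ℕ → K
    e d k = ∑ℕ[ l < B ] δ d (k ℕ.+ l) (c k l)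

    off-diagonal : ∀ l′ → l′ ≢ l → δ (k ℕ.+ l) (k ℕ.+ l′) (c k l′) ≡ 0K
    off-diagonal l′ l′≢l = δ-≢ (c k l′) (λ eq → l′≢l (sym (ℕ.+-cancelˡ-≡ k l l′ eq)))

    e-regroup : ∀ d w → ∑ℕ[ k < B ] (e d k *K (w ^ k)) ≡ ∑ℕ[ k < B ] ∑ℕ[ l < B ] δ d (k ℕ.+ l) (c k l *K (w ^ k))
    e-regroup d w = ∑ℕ-cong B λ k _ →
      trans (∑ℕ-distribʳ-* B (λ l → δ d (k ℕ.+ l) (c k l)) (w ^ k)) (∑ℕ-cong B λ l _ → δ-*ʳ d (k ℕ.+ l) (c k l) (w ^ k))

    vanish-along-ray : ∀ m t → ∑ℕ[ d < B ℕ.+ B ] ((∑ℕ[ k < B ] (e d k *K (ω m ^ k))) *K (τ (point m t) ^ d)) ≡ 0K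
    vanish-along-ray m t = begin
      ∑ℕ[ d < B ℕ.+ B ] ((∑ℕ[ k < B ] (e d k *K (w ^ k))) *K (u ^ d))
        ≡⟨ ∑ℕ-cong (B ℕ.+ B) (λ d _ → cong (_*K (u ^ d)) (e-regroup d w)) ⟩
      ∑ℕ[ d < B ℕ.+ B ] ((∑ℕ[ k < B ] ∑ℕ[ l < B ] δ d (k ℕ.+ l) (c k l *K (w ^ k))) *K (u ^ d))
        ≡⟨ ∑ℕ-regroup B (λ k l → c k l *K (w ^ k)) (u ^_) ⟨
      ∑ℕ[ k < B ] ∑ℕ[ l < B ] ((c k l *K (w ^ k)) *K (u ^ (k ℕ.+ l)))
        ≡⟨ ∑ℕ-cong B (λ k _ → ∑ℕ-cong B λ l _ → trans (KR.*-assoc (c k l) (w ^ k) (u ^ (k ℕ.+ l)))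
                                                      (cong (c k l *K_) (sym (monomial-factor a w k l a≡wu)))) ⟩
      ∑ℕ[ k < B ] ∑ℕ[ l < B ] (c k l *K ((a ^K k) *K (u ^K l)))
        ≡⟨ vanish a ⟩
      0K ∎
      where
      a = point m t
      u = τ a
      w = ω m
      a≡wu = point≡ω*τpoint m t

    e-along-ray≡0 : ∀ m d → d < B ℕ.+ B → ∑ℕ[ k < B ] (e d k *K (ω m ^ k)) ≡ 0K
    e-along-ray≡0 m = roots⇒coefficients≈0 (τ ∘ point m) (τpoint-injective m) (B ℕ.+ B)
                        (λ d → ∑ℕ[ k < B ] (e d k *K (ω m ^ k))) (vanish-along-ray m)

    e≡0 : ∀ d → d < B ℕ.+ B → ∀ k → k < B → e d k ≡ 0K
    e≡0 d d<2B = roots⇒coefficients≈0 ω ω-injective B (e d) (λ m → e-along-ray≡0 m d d<2B)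

  vanishing⇒coefficients≡0 : ∀ n B (c : Vec ℕ n → Vec ℕ n → K) →
                             (∀ a → boxSum n B (λ i j → c i j *K monoEval a i j) ≡ 0K) →
                             ∀ {i j} → InBox B i → InBox B j → c i j ≡ 0K
  vanishing⇒coefficients≡0 zero    B c vanish [] [] = trans (sym (KR.*-identityʳ (c [] []))) (vanish [])
  vanishing⇒coefficients≡0 (suc n) B c vanish {k ∷ i} {l ∷ j} (k<B ∷ i∈B) (l<B ∷ j∈B) =
    vanishing⇒coefficients≡0 n B (λ i j → c (k ∷ i) (l ∷ j)) slice-vanishes i∈B j∈B
    where
    slice : Vec K n → ℕ → ℕ → K
    slice as k l = boxSum n B (λ i j → c (k ∷ i) (l ∷ j) *K monoEval as i j)
    slice-vanishes : ∀ as → slice as k l ≡ 0K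
    slice-vanishes as = vanishing₁⇒coefficients≡0 B (slice as)
                          (λ a → trans (∑ℕ-cong B λ k _ → ∑ℕ-cong B λ l _ → factor a k l) (vanish (a ∷ as))) k<B l<B
      where
      factor : ∀ a k l → slice as k l *K ((a ^K k) *K (τ a ^K l))
                       ≡ boxSum n B (λ i j → c (k ∷ i) (l ∷ j) *K monoEval (a ∷ as) (k ∷ i) (l ∷ j))
      factor a k l = trans (boxSum-distribʳ-* n B _ ((a ^K k) *K (τ a ^K l))) (boxSum-cong n B λ i j →
        xy∙z≈x∙zy (c (k ∷ i) (l ∷ j)) (monoEval as i j) ((a ^K k) *K (τ a ^K l)))

  -- Outside a box containing all exponents both coefficients vanish; inside it the
  -- difference of the coefficient functions has a vanishing box sum.
  eval≡⇒≈P : ∀ {n} (p q : GPoly n) → (∀ a → eval p a ≡ eval q a) → p ≈P q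
  eval≡⇒≈P {n} p q p≗q i j with bounded₂ p q
  ... | B , p∈B , q∈B with VecAll.all? (ℕ._<? B) i ×-dec VecAll.all? (ℕ._<? B) j
  ...   | no  outside      = trans (coeff-outside B p i j p∈B outside) (sym (coeff-outside B q i j q∈B outside))
  ...   | yes (i∈B , j∈B) =
    x∙y⁻¹≈ε⇒x≈y (coeff p i j) (coeff q i j) (vanishing⇒coefficients≡0 n B difference difference-vanishes i∈B j∈B)
    where
    difference : Vec ℕ n → Vec ℕ n → K
    difference i j = coeff p i j KR.- coeff q i j
    difference-vanishes : ∀ a → boxSum n B (λ i j → difference i j *K monoEval a i j) ≡ 0K
    difference-vanishes a = +-identityˡ-unique _ (coeffSum B q a) (begin
      boxSum n B (λ i j → difference i j *K monoEval a i j) +K coeffSum B q a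
        ≡⟨ boxSum-distrib-+ n B _ _ ⟨
      boxSum n B (λ i j → (difference i j *K monoEval a i j) +K (coeff q i j *K monoEval a i j))
        ≡⟨ boxSum-cong n B (λ i j → trans (sym (KR.distribʳ (monoEval a i j) (difference i j) (coeff q i j)))
                                          (cong (_*K monoEval a i j) (//-rightDividesˡ (coeff q i j) (coeff p i j)))) ⟩
      coeffSum B p a  ≡⟨ eval≡coeffSum B p a p∈B ⟨
      eval p a        ≡⟨ p≗q a ⟩
      eval q a        ≡⟨ eval≡coeffSum B q a q∈B ⟩
      coeffSum B q a  ∎)

-- Rational coordinates

module RationalCoordinates (D : ℤ) where

  open QuadraticField D
  open GeneralizedPolynomials D
  open ≡-Reasoning

  evalExpr : ∀ {n} → QExpr n → Vec K n → K
  evalExpr (cst q)  a = ι q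
  evalExpr (genX k) a = lookup a k +K τ (lookup a k)
  evalExpr (genY k) a = (√D *K lookup a k) +K (τ √D *K τ (lookup a k))
  evalExpr (e ⊕ f)  a = evalExpr e a +K evalExpr f a
  evalExpr (e ⊗ f)  a = evalExpr e a *K evalExpr f a

  eval⟦⟧≡evalExpr : ∀ {n} (e : QExpr n) a → eval ⟦ e ⟧ a ≡ evalExpr e a
  eval⟦⟧≡evalExpr (cst q)  a = eval-constP (ι q) a
  eval⟦⟧≡evalExpr (genX k) a = trans (eval-++ (zP k) (τzP k) a) (cong₂ _+K_ (eval-zP k a) (eval-τzP k a))
  eval⟦⟧≡evalExpr (genY k) a = begin
    eval ((constP √D *P zP k) ++ (constP (τ √D) *P τzP k)) a
      ≡⟨ eval-++ (constP √D *P zP k) (constP (τ √D) *P τzP k) a ⟩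
    eval (constP √D *P zP k) a +K eval (constP (τ √D) *P τzP k) a
      ≡⟨ cong₂ _+K_ (eval-*P (constP √D) (zP k) a) (eval-*P (constP (τ √D)) (τzP k) a) ⟩
    (eval (constP √D) a *K eval (zP k) a) +K (eval (constP (τ √D)) a *K eval (τzP k) a)
      ≡⟨ cong₂ _+K_ (cong₂ _*K_ (eval-constP √D a) (eval-zP k a))
                    (cong₂ _*K_ (eval-constP (τ √D) a) (eval-τzP k a)) ⟩
    (√D *K lookup a k) +K (τ √D *K τ (lookup a k)) ∎
  eval⟦⟧≡evalExpr (e ⊕ f)  a =
    trans (eval-++ ⟦ e ⟧ ⟦ f ⟧ a) (cong₂ _+K_ (eval⟦⟧≡evalExpr e a) (eval⟦⟧≡evalExpr f a))
  eval⟦⟧≡evalExpr (e ⊗ f)  a =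
    trans (eval-*P ⟦ e ⟧ ⟦ f ⟧ a) (cong₂ _*K_ (eval⟦⟧≡evalExpr e a) (eval⟦⟧≡evalExpr f a))

  evalExpr-rational : ∀ {n} (e : QExpr n) a → im (evalExpr e a) ≡ 0ℚ
  evalExpr-rational (cst q)  a = refl
  evalExpr-rational (genX k) a = ℚ.+-inverseʳ (im (lookup a k))
  evalExpr-rational (genY k) a = im-y (re (lookup a k)) (im (lookup a k))
    where
    open import Data.Rational using (_+_; _*_; -_)
    im-y : ∀ r s → (0ℚ * s + 1ℚ * r) + (0ℚ * (- s) + (- 1ℚ) * r) ≡ 0ℚ
    im-y = solve-∀ ℚ-ring
  evalExpr-rational (e ⊕ f)  a = cong₂ ℚ._+_ (evalExpr-rational e a) (evalExpr-rational f a)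
  evalExpr-rational (e ⊗ f)  a =
    trans (cong₂ (λ u v → r * u + v * s) (evalExpr-rational f a) (evalExpr-rational e a)) (im-product r s)
    where
    open import Data.Rational using (_+_; _*_)
    r = re (evalExpr e a)
    s = re (evalExpr f a)
    im-product : ∀ r s → r * 0ℚ + 0ℚ * s ≡ 0ℚ
    im-product = solve-∀ ℚ-ring

  re-genX : ∀ {n} (k : Fin n) a → re (evalExpr (genX k) a) ≡ (1ℚ ℚ.+ 1ℚ) ℚ.* re (lookup a k)
  re-genX k a = x+x≡2*x (re (lookup a k))

  re-genY : ∀ {n} (k : Fin n) a → re (evalExpr (genY k) a) ≡ (Dℚ ℚ.+ Dℚ) ℚ.* im (lookup a k)
  re-genY k a = re-y Dℚ (re (lookup a k)) (im (lookup a k))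
    where
    open import Data.Rational using (_+_; _*_; -_)
    re-y : ∀ D r s → (0ℚ * r + D * (1ℚ * s)) + (0ℚ * r + D * ((- 1ℚ) * (- s))) ≡ (D + D) * s
    re-y = solve-∀ ℚ-ring

  record Coordinates {n} (f : Vec K n → K) : Set where
    field
      reExpr imExpr  : QExpr n
      reExpr-correct : ∀ a → evalExpr reExpr a ≡ ι (re (f a))
      imExpr-correct : ∀ a → evalExpr imExpr a ≡ ι (im (f a))

  open Coordinates

  coordinates-cong : ∀ {n} {f g : Vec K n → K} → (∀ a → f a ≡ g a) → Coordinates f → Coordinates g
  coordinates-cong f≗g F = record
    { reExpr = reExpr F ; imExpr = imExpr F
    ; reExpr-correct = λ a → trans (reExpr-correct F a) (cong (ι ∘ re) (f≗g a))
    ; imExpr-correct = λ a → trans (imExpr-correct F a) (cong (ι ∘ im) (f≗g a)) }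

  coordinates-const : ∀ {n} α → Coordinates {n} (λ _ → α)
  coordinates-const α = record
    { reExpr = cst (re α) ; imExpr = cst (im α) ; reExpr-correct = λ _ → refl ; imExpr-correct = λ _ → refl }

  coordinates-+ : ∀ {n} {f g : Vec K n → K} → Coordinates f → Coordinates g → Coordinates (λ a → f a +K g a)
  coordinates-+ F G = record
    { reExpr = reExpr F ⊕ reExpr G ; imExpr = imExpr F ⊕ imExpr G
    ; reExpr-correct = λ a → cong₂ _+K_ (reExpr-correct F a) (reExpr-correct G a)
    ; imExpr-correct = λ a → cong₂ _+K_ (imExpr-correct F a) (imExpr-correct G a) }

  coordinates-* : ∀ {n} {f g : Vec K n → K} → Coordinates f → Coordinates g → Coordinates (λ a → f a *K g a)
  coordinates-* {f = f} {g} F G = record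
    { reExpr = (reExpr F ⊗ reExpr G) ⊕ (cst Dℚ ⊗ (imExpr F ⊗ imExpr G))
    ; imExpr = (reExpr F ⊗ imExpr G) ⊕ (imExpr F ⊗ reExpr G)
    ; reExpr-correct = λ a → cong₂ _+K_
        (trans (cong₂ _*K_ (reExpr-correct F a) (reExpr-correct G a)) (ι-homo-* (re (f a)) (re (g a))))
        (trans (cong (ι Dℚ *K_) (trans (cong₂ _*K_ (imExpr-correct F a) (imExpr-correct G a)) (ι-homo-* (im (f a)) (im (g a)))))
               (ι-homo-* Dℚ (im (f a) ℚ.* im (g a))))
    ; imExpr-correct = λ a → cong₂ _+K_
        (trans (cong₂ _*K_ (reExpr-correct F a) (imExpr-correct G a)) (ι-homo-* (re (f a)) (im (g a))))
        (trans (cong₂ _*K_ (imExpr-correct F a) (reExpr-correct G a)) (ι-homo-* (im (f a)) (re (g a)))) }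

  coordinates-τ : ∀ {n} {f : Vec K n → K} → Coordinates f → Coordinates (τ ∘ f)
  coordinates-τ {f = f} F = record
    { reExpr = reExpr F ; imExpr = cst (ℚ.- 1ℚ) ⊗ imExpr F
    ; reExpr-correct = reExpr-correct F
    ; imExpr-correct = λ a → trans (cong (ι (ℚ.- 1ℚ) *K_) (imExpr-correct F a))
                                   (trans (ι-homo-* (ℚ.- 1ℚ) (im (f a))) (cong ι (neg-one-* (im (f a))))) }
    where
    open import Data.Rational using (_*_; -_)
    neg-one-* : ∀ x → (- 1ℚ) * x ≡ - x
    neg-one-* = solve-∀ ℚ-ring

  coordinates-^ : ∀ {n} {f : Vec K n → K} → Coordinates f → ∀ k → Coordinates (λ a → f a ^K k)
  coordinates-^ F zero    = coordinates-const 1K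
  coordinates-^ F (suc k) = coordinates-* F (coordinates-^ F k)

  weaken : ∀ {n} → QExpr n → QExpr (suc n)
  weaken (cst q)  = cst q
  weaken (genX k) = genX (suc k)
  weaken (genY k) = genY (suc k)
  weaken (e ⊕ f)  = weaken e ⊕ weaken f
  weaken (e ⊗ f)  = weaken e ⊗ weaken f

  evalExpr-weaken : ∀ {n} (e : QExpr n) x a → evalExpr (weaken e) (x ∷ a) ≡ evalExpr e a
  evalExpr-weaken (cst q)  x a = refl
  evalExpr-weaken (genX k) x a = refl
  evalExpr-weaken (genY k) x a = refl
  evalExpr-weaken (e ⊕ f)  x a = cong₂ _+K_ (evalExpr-weaken e x a) (evalExpr-weaken f x a)
  evalExpr-weaken (e ⊗ f)  x a = cong₂ _*K_ (evalExpr-weaken e x a) (evalExpr-weaken f x a)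

  coordinates-tail : ∀ {n} {f : Vec K n → K} → Coordinates f → Coordinates (f ∘ tail)
  coordinates-tail F = record
    { reExpr = weaken (reExpr F) ; imExpr = weaken (imExpr F)
    ; reExpr-correct = λ { (x ∷ a) → trans (evalExpr-weaken (reExpr F) x a) (reExpr-correct F a) }
    ; imExpr-correct = λ { (x ∷ a) → trans (evalExpr-weaken (imExpr F) x a) (imExpr-correct F a) } }

  module _ (D≢0 : D ≢ 0ℤ) where

    2Dℚ≢0 : Dℚ ℚ.+ Dℚ ≢ 0ℚ
    2Dℚ≢0 2D≡0 = D≢0 (trans (sym (↥[i/1] D)) (cong ↥_ Dℚ≡0))
      where
      Dℚ≡0 : Dℚ ≡ 0ℚ
      Dℚ≡0 = ℚ-*-cancelˡ {1ℚ ℚ.+ 1ℚ} (λ ()) (begin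
        (1ℚ ℚ.+ 1ℚ) ℚ.* Dℚ ≡⟨ x+x≡2*x Dℚ ⟨
        Dℚ ℚ.+ Dℚ          ≡⟨ 2D≡0 ⟩
        0ℚ                 ≡⟨ ℚ.*-zeroʳ (1ℚ ℚ.+ 1ℚ) ⟨
        (1ℚ ℚ.+ 1ℚ) ℚ.* 0ℚ ∎)

    -- re z = x / 2 and im z = y / 2D for x = z + τ z and y = √D z + τ(√D) τ z.
    coordinates-lookup : ∀ {n} (k : Fin n) → Coordinates (λ a → lookup a k)
    coordinates-lookup k = record
      { reExpr = cst (ℚ.1/ 2ℚ) ⊗ genX k
      ; imExpr = cst (ℚ.1/ 2Dℚ) ⊗ genY k
      ; reExpr-correct = λ a → unscale 2ℚ (evalExpr-rational (genX k) a) (re-genX k a)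
      ; imExpr-correct = λ a → unscale 2Dℚ (evalExpr-rational (genY k) a) (re-genY k a) }
      where
      2ℚ 2Dℚ : ℚ
      2ℚ  = 1ℚ ℚ.+ 1ℚ
      2Dℚ = Dℚ ℚ.+ Dℚ
      instance
        _ = ℚ.≢-nonZero {2ℚ} (λ ())
        _ = ℚ.≢-nonZero 2Dℚ≢0
      unscale : ∀ c .{{_ : ℚ.NonZero c}} {x r} → im x ≡ 0ℚ → re x ≡ c ℚ.* r → ι (ℚ.1/ c) *K x ≡ ι r
      unscale c {x} {r} im≡0 re≡cr =
        trans (ι-*K-rational (ℚ.1/ c) x im≡0)
              (cong ι (trans (cong (ℚ.1/ c ℚ.*_) re≡cr) (sym (x≡q⁻¹*[q*x] c r))))

    coordinates-monoEval : ∀ {n} (i j : Vec ℕ n) → Coordinates (λ a → monoEval a i j)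
    coordinates-monoEval []      []      = coordinates-cong (λ { [] → refl }) (coordinates-const 1K)
    coordinates-monoEval (k ∷ i) (l ∷ j) = coordinates-cong (λ { (x ∷ a) → refl })
      (coordinates-* (coordinates-* (coordinates-^ z₀ k) (coordinates-^ (coordinates-τ z₀) l))
                     (coordinates-tail (coordinates-monoEval i j)))
      where z₀ = coordinates-lookup zero

    coordinates-eval : ∀ {n} (g : GPoly n) → Coordinates (eval g)
    coordinates-eval []                = coordinates-const 0K
    coordinates-eval ((α , i , j) ∷ g) =
      coordinates-+ (coordinates-* (coordinates-const α) (coordinates-monoEval i j)) (coordinates-eval g)

  InSubalg⇒InΓ : ∀ {n} (g : GPoly n) → InSubalg g → InΓ g
  InSubalg⇒InΓ g (e , ⟦e⟧≈g) a = begin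
    im (eval g a)        ≡⟨ cong im (≈P⇒eval≡ ⟦ e ⟧ g ⟦e⟧≈g a) ⟨
    im (eval ⟦ e ⟧ a)    ≡⟨ cong im (eval⟦⟧≡evalExpr e a) ⟩
    im (evalExpr e a)    ≡⟨ evalExpr-rational e a ⟩
    0ℚ                   ∎

InΓ⇒InSubalg : ∀ {D} → (∀ q → q ℚ.* q ≢ Field.Dℚ D) → D ≢ 0ℤ →
               ∀ {n} (g : Field.GPoly D n) → Field.InΓ D g → Field.InSubalg D g
InΓ⇒InSubalg {D} nonSquare D≢0 g rational = reExpr C , eval≡⇒≈P ⟦ reExpr C ⟧ g λ a → begin
  eval ⟦ reExpr C ⟧ a   ≡⟨ eval⟦⟧≡evalExpr (reExpr C) a ⟩
  evalExpr (reExpr C) a ≡⟨ reExpr-correct C a ⟩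
  ι (re (eval g a))     ≡⟨ cong (re (eval g a) +√D·_) (rational a) ⟨
  eval g a              ∎
  where
  open QuadraticField D
  open IdentityTheorem D nonSquare
  open RationalCoordinates D
  open Coordinates
  open ≡-Reasoning
  C = coordinates-eval D≢0 g

theorem3p4 : (D : ℤ) → SquareFree D → D ≢ 0ℤ → D ≢ 1ℤ →
    (n : ℕ) → n ≥ 1 →
    (g : Field.GPoly D n) → Field.InΓ D g ⇔ Field.InSubalg D g
theorem3p4 D squareFree D≢0 D≢1 n _ g =
  mk⇔ (InΓ⇒InSubalg (squareFree⇒nonSquare squareFree D≢1) D≢0 g) (RationalCoordinates.InSubalg⇒InΓ D g)
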